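{- For integers $r\ge 3$ and $1 \leq n_1 \leq n_2$, \[ \operatorname{ex}(K_{n_1,n_2,\ldots,n_2}, n_1K_r) = (r-1)n_1n_2+\binom{r-1}{2}n_2^2 - n_1n_2 + n_2(n_1-1), \] where $K_{n_1,n_2,\ldots,n_2}$ is the complete $r$-partite graph with one part of size $n_1$ and $r-1$ parts of size $n_2$.
   Context: All graphs are finite, undirected and simple. A complete $r$-partite graph $K_{n_1,\ldots,n_r}$ has vertex set partitioned into independent sets $V_1,\dots,V_r$ with $|V_i|=n_i$, and every pair of vertices in distinct parts is adjacent. $K_r$ is the complete graph on $r$ vertices and $n_1K_r$ denotes $n_1$ vertex-disjoint copies of $K_r$. For graphs $G,H$, $\operatorname{ex}(G,H)$ is the maximum number of edges in a subgraph of $G$ containing no copy of $H$. The right-hand side equals $\sum_{1\le i<j\le r} n_in_j - n_1n_2 + n_2(n_1-1)$ for part sizes $(n_1,n_2,\ldots,n_2)$. -}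

module Defs where

open import Data.Nat using (ℕ; zero; suc; _+_; _*_; _∸_; _≡ᵇ_; _<ᵇ_)
open import Data.Fin using (Fin; toℕ; splitAt; quotient)
open import Data.Fin.Base using ()
open import Data.Bool using (Bool; true; false; not; _∧_; if_then_else_)
open import Data.Sum using (inj₁; inj₂)
open import Data.Product using (_×_; Σ; ∃)
open import Relation.Binary.PropositionalEquality using (_≡_; _≢_)

Adj : ℕ → Set
Adj N = Fin N → Fin N → Bool

count : ∀ {n} → (Fin n → Bool) → ℕ
count {zero}  f = 0
count {suc n} f = (if f Fin.zero then 1 else 0) + count (λ i → f (Fin.suc i))
  where import Data.Fin as Fin

sumFin : ∀ {n} → (Fin n → ℕ) → ℕ
sumFin {zero}  f = 0
sumFin {suc n} f = f Fin.zero + sumFin (λ i → f (Fin.suc i))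
  where import Data.Fin as Fin

edges : ∀ {N} → Adj N → ℕ
edges H = sumFin (λ u → count (λ v → (toℕ u <ᵇ toℕ v) ∧ H u v))

verts : ℕ → ℕ → ℕ → ℕ
verts r n₁ n₂ = n₁ + (r ∸ 1) * n₂

-- part index of a vertex: the first n₁ vertices form part 0, the remaining
-- (r-1)·n₂ vertices are split into r-1 consecutive blocks of size n₂ (parts 1..r-1)
part : (r n₁ n₂ : ℕ) → Fin (verts r n₁ n₂) → ℕ
part r n₁ n₂ v with splitAt n₁ v
... | inj₁ _ = 0
... | inj₂ w = suc (toℕ (quotient {r ∸ 1} n₂ w))

Kpart : (r n₁ n₂ : ℕ) → Adj (verts r n₁ n₂)
Kpart r n₁ n₂ u v = not (part r n₁ n₂ u ≡ᵇ part r n₁ n₂ v)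

IsSubgraph : ∀ {N} → Adj N → Adj N → Set
IsSubgraph {N} G H =
  ((u v : Fin N) → H u v ≡ H v u) × ((u v : Fin N) → H u v ≡ true → G u v ≡ true)

ContainsDisjointCliques : ∀ {N} → (t r : ℕ) → Adj N → Set
ContainsDisjointCliques {N} t r H =
  Σ (Fin t → Fin r → Fin N) λ f →
    ((a b : Fin t) (i j : Fin r) → f a i ≡ f b j → (a ≡ b) × (i ≡ j)) ×
    ((a : Fin t) (i j : Fin r) → i ≢ j → H (f a i) (f a j) ≡ true)

ExEq : ∀ {N} → Adj N → (t r : ℕ) → ℕ → Set
ExEq {N} G t r m =
  (Σ (Adj N) λ H → IsSubgraph G H × (¬ ContainsDisjointCliques t r H) × (edges H ≡ m)) ×
  ((H : Adj N) → IsSubgraph G H → ¬ ContainsDisjointCliques t r H → edges H Data.Nat.≤ m)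
  where open import Relation.Nullary using (¬_)
        import Data.Nat

-- Lower bound (module Extremal): delete the n₂ edges joining the first vertex z of V₀
-- to V₁.  A K_r in K meets every part once, so n₁ disjoint copies exhaust V₀ and one
-- of them passes through z, which has lost all its neighbours in V₁.
--
-- Upper bound (module Greedy, for any complete multipartite graph): call a vertex of
-- a set S clean if it lies on no edge of K missing from H inside S.  If each part of
-- S other than V₀ has more than n vertices and fewer than n edges are missing inside
-- S, fewer than n vertices per part are touched by missing edges, so every part has a
-- clean vertex; with one possibly unclean pivot w they form a K_r of H.  Removing it
-- keeps the invariant for n − 1, since the pivot's missing edge disappears.  Hence a
-- subgraph missing fewer than n₂ edges contains n₁ disjoint K_r.

module Submission where

open import Defs
open import Data.Nat using (ℕ; zero; suc; _+_; _*_; _∸_; _^_; _≤_; _<_; _≡ᵇ_; _<ᵇ_; z≤n; s≤s; s≤s⁻¹; z<s)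
open import Data.Nat.Properties
open import Data.Nat.Tactic.RingSolver using (solve-∀)
open import Data.Nat.Combinatorics using (_C_; nC1≡n; nCk+nC[k+1]≡[n+1]C[k+1])
open import Data.Fin as F using (Fin; toℕ; fromℕ<; _↑ˡ_; _↑ʳ_; splitAt; quotient)
open import Data.Fin.Properties using (toℕ-injective; toℕ<n; toℕ-fromℕ<; toℕ-↑ˡ; splitAt-↑ˡ; splitAt-↑ʳ; splitAt⁻¹-↑ˡ; any?; injective⇒≤; punchOut-injective)
open import Function.Definitions using (Injective)
open import Data.Bool using (Bool; true; false; not; _∧_; _∨_; T; if_then_else_)
open import Data.Bool.Properties using (∧-zeroʳ; ∧-identityʳ; ∨-comm; ¬-not)
import Data.Bool.Properties as BoolP
open import Data.Sum using (_⊎_; inj₁; inj₂)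
open import Data.Product using (_×_; _,_; ∃; proj₁; proj₂)
open import Data.Empty using (⊥-elim)
open import Data.Unit using (tt)
open import Relation.Nullary using (¬_; yes; no; Dec)
open import Relation.Binary.PropositionalEquality

infixr 5 _∙_
_∙_ : ∀ {A : Set} {x y z : A} → x ≡ y → y ≡ z → x ≡ z
_∙_ = trans

true≢false : true ≢ false
true≢false ()

≡ᵇ⇒≡′ : ∀ m n → (m ≡ᵇ n) ≡ true → m ≡ n
≡ᵇ⇒≡′ m n e = ≡ᵇ⇒≡ m n (subst T (sym e) tt)

≡ᵇ-refl : ∀ m → (m ≡ᵇ m) ≡ true
≡ᵇ-refl zero = refl
≡ᵇ-refl (suc m) = ≡ᵇ-refl m

≢⇒≡ᵇ-false : ∀ m n → m ≢ n → (m ≡ᵇ n) ≡ false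
≢⇒≡ᵇ-false m n m≢n with m ≡ᵇ n in e
... | true = ⊥-elim (m≢n (≡ᵇ⇒≡′ m n e))
... | false = refl

≡ᵇ-sym : ∀ m n → (m ≡ᵇ n) ≡ (n ≡ᵇ m)
≡ᵇ-sym zero zero = refl
≡ᵇ-sym zero (suc n) = refl
≡ᵇ-sym (suc m) zero = refl
≡ᵇ-sym (suc m) (suc n) = ≡ᵇ-sym m n

∧-true-left : ∀ {a b} → a ∧ b ≡ true → a ≡ true
∧-true-left {true} _ = refl

∧-true-right : ∀ {a b} → a ∧ b ≡ true → b ≡ true
∧-true-right {true} e = e

ind : Bool → ℕ
ind true = 1
ind false = 0

ind-mono : ∀ {a b} → (a ≡ true → b ≡ true) → ind a ≤ ind b
ind-mono {false} _ = z≤n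
ind-mono {true} a⇒b rewrite a⇒b refl = ≤-refl

count-as-sum : ∀ {n} (f : Fin n → Bool) → count f ≡ sumFin (λ i → ind (f i))
count-as-sum {zero} f = refl
count-as-sum {suc n} f = cong₂ _+_ (lemma (f F.zero)) (count-as-sum (λ i → f (F.suc i)))
  where lemma : ∀ b → (if b then 1 else 0) ≡ ind b
        lemma true = refl
        lemma false = refl

sum-cong : ∀ {n} {f g : Fin n → ℕ} → (∀ i → f i ≡ g i) → sumFin f ≡ sumFin g
sum-cong {zero} e = refl
sum-cong {suc n} e = cong₂ _+_ (e F.zero) (sum-cong (λ i → e (F.suc i)))

sum-mono : ∀ {n} {f g : Fin n → ℕ} → (∀ i → f i ≤ g i) → sumFin f ≤ sumFin g
sum-mono {zero} _ = z≤n
sum-mono {suc n} le = +-mono-≤ (le F.zero) (sum-mono (λ i → le (F.suc i)))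

sum-+ : ∀ {n} (f g : Fin n → ℕ) → sumFin (λ i → f i + g i) ≡ sumFin f + sumFin g
sum-+ {zero} f g = refl
sum-+ {suc n} f g =
  cong (f F.zero + g F.zero +_) (sum-+ (λ i → f (F.suc i)) (λ i → g (F.suc i)))
  ∙ +-+-comm (f F.zero) (g F.zero) _ _
  where +-+-comm : ∀ a b c d → a + b + (c + d) ≡ a + c + (b + d)
        +-+-comm = solve-∀

sum-const : ∀ {n} c → sumFin {n} (λ _ → c) ≡ n * c
sum-const {zero} c = refl
sum-const {suc n} c = cong (c +_) (sum-const {n} c)

sum-zero : ∀ {n} (f : Fin n → ℕ) → (∀ i → f i ≡ 0) → sumFin f ≡ 0
sum-zero {n} f f≡0 = sum-cong f≡0 ∙ sum-const {n} 0 ∙ *-zeroʳ n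

sum-* : ∀ {n} c (f : Fin n → ℕ) → sumFin (λ i → c * f i) ≡ c * sumFin f
sum-* {zero} c f = sym (*-zeroʳ c)
sum-* {suc n} c f =
  cong (c * f F.zero +_) (sum-* c (λ i → f (F.suc i))) ∙ sym (*-distribˡ-+ c (f F.zero) _)

sum-swap : ∀ {m n} (h : Fin m → Fin n → ℕ) →
  sumFin (λ u → sumFin (λ v → h u v)) ≡ sumFin (λ v → sumFin (λ u → h u v))
sum-swap {zero} {n} h = sym (sum-zero {n} (λ _ → 0) (λ _ → refl))
sum-swap {suc m} h =
  cong (sumFin (h F.zero) +_) (sum-swap (λ u v → h (F.suc u) v))
  ∙ sym (sum-+ (h F.zero) (λ v → sumFin (λ u → h (F.suc u) v)))

sum-++ : ∀ m {n} (f : Fin (m + n) → ℕ) →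
  sumFin f ≡ sumFin (λ i → f (i ↑ˡ n)) + sumFin (λ j → f (m ↑ʳ j))
sum-++ zero f = refl
sum-++ (suc m) f = cong (f F.zero +_) (sum-++ m (λ i → f (F.suc i))) ∙ sym (+-assoc (f F.zero) _ _)

term≤sum : ∀ {n} (f : Fin n → ℕ) i → f i ≤ sumFin f
term≤sum f F.zero = m≤m+n _ _
term≤sum f (F.suc i) = ≤-trans (term≤sum (λ j → f (F.suc j)) i) (m≤n+m _ (f F.zero))

sum-positive : ∀ {n} (f : Fin n → ℕ) → 0 < sumFin f → ∃ λ i → 0 < f i
sum-positive {suc n} f pos with f F.zero in e
... | suc _ = F.zero , subst (0 <_) (sym e) z<s
... | zero with sum-positive (λ i → f (F.suc i)) pos
... | i , p = F.suc i , p

sum-< : ∀ {n} {f g : Fin n → ℕ} → (∀ i → f i ≤ g i) → (i : Fin n) → f i < g i → sumFin f < sumFin g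
sum-< le F.zero lt = +-mono-<-≤ lt (sum-mono (λ i → le (F.suc i)))
sum-< le (F.suc i) lt = +-mono-≤-< (le F.zero) (sum-< (λ i → le (F.suc i)) i lt)

+-mono-<₂ : ∀ {a b c d} → a < c → b < d → 2 + (a + b) ≤ c + d
+-mono-<₂ {a} {b} {c} {d} p q = subst (_≤ c + d) (cong suc (+-suc a b)) (+-mono-≤ p q)

sum-<₂ : ∀ {n} {f g : Fin n → ℕ} → (∀ i → f i ≤ g i) → (i j : Fin n) → i ≢ j →
  f i < g i → f j < g j → 2 + sumFin f ≤ sumFin g
sum-<₂ le F.zero F.zero i≢j _ _ = ⊥-elim (i≢j refl)
sum-<₂ le F.zero (F.suc j) _ lt lt′ = +-mono-<₂ lt (sum-< (λ k → le (F.suc k)) j lt′)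
sum-<₂ le (F.suc i) F.zero _ lt lt′ = +-mono-<₂ lt′ (sum-< (λ k → le (F.suc k)) i lt)
sum-<₂ {f = f} {g} le (F.suc i) (F.suc j) i≢j lt lt′ =
  subst (_≤ sumFin g) (+-comm (f F.zero) _ ∙ +-assoc 2 _ (f F.zero) ∙ cong (2 +_) (+-comm _ (f F.zero)))
    (+-mono-≤ (le F.zero) (sum-<₂ (λ k → le (F.suc k)) i j (λ e → i≢j (cong F.suc e)) lt lt′))

search : ∀ {n} (p : Fin n → Bool) → (∃ λ i → p i ≡ true) ⊎ (∀ i → p i ≡ false)
search p with any? (λ i → p i BoolP.≟ true)
... | yes found = inj₁ found
... | no none = inj₂ (λ i → ¬-not (λ e → none (i , e)))

count-false : ∀ {n} → count {n} (λ _ → false) ≡ 0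
count-false {zero} = refl
count-false {suc n} = count-false {n}

count-not : ∀ {n} (p : Fin n → Bool) → count (λ i → not (p i)) + count p ≡ n
count-not {zero} p = refl
count-not {suc n} p with p F.zero
... | true = +-suc _ _ ∙ cong suc (count-not (λ i → p (F.suc i)))
... | false = cong suc (count-not (λ i → p (F.suc i)))

is : ∀ {n} → Fin n → Fin n → Bool
is x i = toℕ x ≡ᵇ toℕ i

count-is : ∀ {n} (x : Fin n) → count (is x) ≡ 1
count-is {suc n} F.zero = cong suc (count-false {n})
count-is (F.suc x) = count-is x

count-gap : ∀ {n} (p q : Fin n → Bool) → count q < count p → ∃ λ i → p i ≡ true × q i ≡ false
count-gap p q lt with search (λ i → p i ∧ not (q i))
... | inj₁ (i , e) = i , witness (p i) (q i) e
  where witness : ∀ a b → a ∧ not b ≡ true → a ≡ true × b ≡ false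
        witness true false _ = refl , refl
... | inj₂ none = ⊥-elim (<⇒≱ lt (subst₂ _≤_ (sym (count-as-sum p)) (sym (count-as-sum q))
                                    (sum-mono (λ i → dominated (p i) (q i) (none i)))))
  where dominated : ∀ a b → a ∧ not b ≡ false → ind a ≤ ind b
        dominated true true _ = ≤-refl
        dominated false b _ = z≤n

count-≤-+1 : ∀ {n} (f g : Fin n → Bool) (x : Fin n) → (∀ i → g i ≡ true → f i ≡ true ⊎ i ≡ x) →
  count g ≤ count f + 1
count-≤-+1 f g x g⊆f∪x = begin
  count g                                      ≡⟨ count-as-sum g ⟩
  sumFin (λ i → ind (g i))                     ≤⟨ sum-mono pointwise ⟩
  sumFin (λ i → ind (f i) + ind (is x i))      ≡⟨ sum-+ (λ i → ind (f i)) (λ i → ind (is x i)) ⟩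
  sumFin (λ i → ind (f i)) + sumFin (λ i → ind (is x i))
                                               ≡⟨ cong₂ _+_ (sym (count-as-sum f)) (sym (count-as-sum (is x)) ∙ count-is x) ⟩
  count f + 1                                  ∎
  where
  open ≤-Reasoning
  pointwise : ∀ i → ind (g i) ≤ ind (f i) + ind (is x i)
  pointwise i with g i in gi
  ... | false = z≤n
  ... | true with g⊆f∪x i gi
  ... | inj₁ fi rewrite fi = m≤m+n 1 _
  ... | inj₂ refl rewrite ≡ᵇ-refl (toℕ i) = m≤n+m 1 (ind (f i))

injective⇒surjective : ∀ {m} (g : Fin m → Fin m) → Injective _≡_ _≡_ g → ∀ y → ∃ λ i → g i ≡ y
injective⇒surjective {suc m} g g-inj y with any? (λ i → g i F.≟ y)
... | yes hit = hit
... | no miss = ⊥-elim (1+n≰n (injective⇒≤ h-inj))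
  where
  y≢g : ∀ i → y ≢ g i
  y≢g i e = miss (i , sym e)
  h : Fin (suc m) → Fin m
  h i = F.punchOut (y≢g i)
  h-inj : Injective _≡_ _≡_ h
  h-inj e = g-inj (punchOut-injective (y≢g _) (y≢g _) e)

<ᵇ-trichotomy : ∀ a b → a ≢ b → ind (a <ᵇ b) + ind (b <ᵇ a) ≡ 1
<ᵇ-trichotomy zero zero a≢b = ⊥-elim (a≢b refl)
<ᵇ-trichotomy zero (suc b) _ = refl
<ᵇ-trichotomy (suc a) zero _ = refl
<ᵇ-trichotomy (suc a) (suc b) a≢b = <ᵇ-trichotomy a b (λ e → a≢b (cong suc e))

handshake : ∀ {N} (R : Adj N) → (∀ u v → R u v ≡ R v u) → (∀ u → R u u ≡ false) →
  sumFin (λ u → count (R u)) ≡ 2 * edges R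
handshake {N} R R-sym R-irr = begin
  sumFin (λ u → count (R u))                            ≡⟨ sum-cong (λ u → count-as-sum (R u) ∙ sum-cong (both-orders u)) ⟩
  sumFin (λ u → sumFin (λ v → A u v + A v u))           ≡⟨ sum-cong (λ u → sum-+ (A u) (λ v → A v u)) ⟩
  sumFin (λ u → sumFin (A u) + sumFin (λ v → A v u))    ≡⟨ sum-+ (λ u → sumFin (A u)) _ ⟩
  X + sumFin (λ u → sumFin (λ v → A v u))               ≡⟨ cong (X +_) (sum-swap (λ u v → A v u)) ⟩
  X + X                                                 ≡⟨ cong (X +_) (sym (+-identityʳ X)) ⟩
  2 * X                                                 ≡⟨ cong (2 *_) (sum-cong (λ u → sym (count-as-sum (λ v → (toℕ u <ᵇ toℕ v) ∧ R u v)))) ⟩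
  2 * edges R                                           ∎
  where
  open ≡-Reasoning
  A : Fin N → Fin N → ℕ
  A u v = ind ((toℕ u <ᵇ toℕ v) ∧ R u v)
  X : ℕ
  X = sumFin (λ u → sumFin (A u))
  both-orders : ∀ u v → ind (R u v) ≡ A u v + A v u
  both-orders u v rewrite R-sym v u with R u v in e
  ... | false rewrite ∧-zeroʳ (toℕ u <ᵇ toℕ v) | ∧-zeroʳ (toℕ v <ᵇ toℕ u) = refl
  ... | true rewrite ∧-identityʳ (toℕ u <ᵇ toℕ v) | ∧-identityʳ (toℕ v <ᵇ toℕ u) =
    sym (<ᵇ-trichotomy (toℕ u) (toℕ v) (λ eq → u≢v (toℕ-injective eq)))
    where
    u≢v : u ≢ v
    u≢v refl = true≢false (sym e ∙ R-irr u)

_∖_ : ∀ {N} → Adj N → Adj N → Adj N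
(G ∖ H) u v = G u v ∧ not (H u v)

edges-∖ : ∀ {N} (G H : Adj N) → (∀ u v → H u v ≡ true → G u v ≡ true) →
  edges G ≡ edges H + edges (G ∖ H)
edges-∖ {N} G H H⊆G =
  sum-cong (λ u → count-as-sum (λ v → lt u v ∧ G u v) ∙ sum-cong (λ v → split (lt u v) (G u v) (H u v) (H⊆G u v))
                 ∙ sum-+ (λ v → ind (lt u v ∧ H u v)) (λ v → ind (lt u v ∧ (G ∖ H) u v))
                 ∙ cong₂ _+_ (sym (count-as-sum (λ v → lt u v ∧ H u v)))
                             (sym (count-as-sum (λ v → lt u v ∧ (G ∖ H) u v))))
  ∙ sum-+ (λ u → count (λ v → lt u v ∧ H u v)) (λ u → count (λ v → lt u v ∧ (G ∖ H) u v))
  where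
  lt : Fin N → Fin N → Bool
  lt u v = toℕ u <ᵇ toℕ v
  split : ∀ l g h → (h ≡ true → g ≡ true) → ind (l ∧ g) ≡ ind (l ∧ h) + ind (l ∧ (g ∧ not h))
  split false g h _ = refl
  split true g true h⇒g rewrite h⇒g refl = refl
  split true true false _ = refl
  split true false false _ = refl

sum-product : ∀ {m} (A B : Fin m → Bool) →
  sumFin (λ u → sumFin (λ v → ind (A u ∧ B v))) ≡ count A * count B
sum-product {m} A B = begin
  sumFin (λ u → sumFin (λ v → ind (A u ∧ B v)))  ≡⟨ sum-cong (λ u → sum-cong (λ v → ind-∧ (A u) (B v)) ∙ sum-* (ind (A u)) (λ v → ind (B v))) ⟩
  sumFin (λ u → ind (A u) * ΣB)                  ≡⟨ sum-cong (λ u → *-comm (ind (A u)) ΣB) ∙ sum-* ΣB (λ u → ind (A u)) ⟩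
  ΣB * ΣA                                        ≡⟨ *-comm ΣB ΣA ∙ sym (cong₂ _*_ (count-as-sum A) (count-as-sum B)) ⟩
  count A * count B                              ∎
  where
  open ≡-Reasoning
  ind-∧ : ∀ x y → ind (x ∧ y) ≡ ind x * ind y
  ind-∧ true true = refl
  ind-∧ true false = refl
  ind-∧ false y = refl
  ΣA ΣB : ℕ
  ΣA = sumFin (λ u → ind (A u))
  ΣB = sumFin (λ v → ind (B v))

module Multipartite {N : ℕ} (P : Fin N → ℕ) where

  K : Adj N
  K u v = not (P u ≡ᵇ P v)

  K-sym : ∀ u v → K u v ≡ K v u
  K-sym u v = cong not (≡ᵇ-sym (P u) (P v))

  K-irr : ∀ u → K u u ≡ false
  K-irr u rewrite ≡ᵇ-refl (P u) = refl

  K-edge⇒parts-differ : ∀ u v → K u v ≡ true → P u ≢ P v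
  K-edge⇒parts-differ u v e eq rewrite eq | ≡ᵇ-refl (P v) = true≢false (sym e)

  parts-differ⇒K-edge : ∀ u v → P u ≢ P v → K u v ≡ true
  parts-differ⇒K-edge u v ne rewrite ≢⇒≡ᵇ-false (P u) (P v) ne = refl

module Greedy {N : ℕ} (r : ℕ) (P : Fin N → ℕ) (P<r : ∀ v → P v < r)
              (H : Adj N) (H-sym : ∀ u v → H u v ≡ H v u)
              (H⊆K : ∀ u v → H u v ≡ true → Multipartite.K P u v ≡ true) where

  open Multipartite P

  Sub : Set
  Sub = Fin N → Bool

  missing : Sub → Fin N → Fin N → Bool
  missing S u v = S u ∧ (S v ∧ (K ∖ H) u v)

  mdeg : Sub → Fin N → ℕ
  mdeg S u = count (missing S u)

  mtotal : Sub → ℕ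
  mtotal S = sumFin (mdeg S)

  inPart : Sub → ℕ → Fin N → Bool
  inPart S k v = S v ∧ (P v ≡ᵇ k)

  size : Sub → ℕ → ℕ
  size S k = count (inPart S k)

  touched : Sub → Fin N → Bool
  touched S u = not (mdeg S u ≡ᵇ 0)

  Clean : Sub → Fin N → Set
  Clean S x = ∀ y → missing S x y ≡ false

  missing-sym : ∀ S u v → missing S u v ≡ missing S v u
  missing-sym S u v rewrite K-sym u v | H-sym u v with S u | S v
  ... | true | true = refl
  ... | true | false = refl
  ... | false | true = refl
  ... | false | false = refl

  missing⇒K-edge : ∀ S u v → missing S u v ≡ true → K u v ≡ true
  missing⇒K-edge S u v e = ∧-true-left {K u v} (∧-true-right {S v} (∧-true-right {S u} e))

  missing-mono : ∀ S S′ → (∀ v → S′ v ≡ true → S v ≡ true) →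
    ∀ u v → missing S′ u v ≡ true → missing S u v ≡ true
  missing-mono S S′ S′⊆S u v e
    rewrite S′⊆S u (∧-true-left {S′ u} e) | S′⊆S v (∧-true-left {S′ v} (∧-true-right {S′ u} e)) =
    ∧-true-right {S′ v} (∧-true-right {S′ u} e)

  untouched⇒clean : ∀ S x → touched S x ≡ false → Clean S x
  untouched⇒clean S x untouched y with missing S x y in e
  ... | false = refl
  ... | true = ⊥-elim (1+n≰n (begin
        1                                       ≡⟨ cong ind (sym e) ⟩
        ind (missing S x y)                     ≤⟨ term≤sum (λ v → ind (missing S x v)) y ⟩
        sumFin (λ v → ind (missing S x v))      ≡⟨ sym (count-as-sum (missing S x)) ⟩
        mdeg S x                                ≡⟨ degree-zero (mdeg S x) untouched ⟩
        0                                       ∎))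
    where
    open ≤-Reasoning
    degree-zero : ∀ d → not (d ≡ᵇ 0) ≡ false → d ≡ 0
    degree-zero zero _ = refl

  touched⇒missing : ∀ S x → touched S x ≡ true → ∃ λ y → missing S x y ≡ true
  touched⇒missing S x e
    with sum-positive (λ v → ind (missing S x v)) (subst (0 <_) (count-as-sum (missing S x)) (positive (mdeg S x) e))
    where positive : ∀ d → not (d ≡ᵇ 0) ≡ true → 0 < d
          positive (suc d) _ = z<s
  ... | y , p = y , from-ind (missing S x y) p
    where from-ind : ∀ b → 0 < ind b → b ≡ true
          from-ind true _ = refl

  clean⇒H-edge : ∀ S x y → Clean S x → S x ≡ true → S y ≡ true → K x y ≡ true → H x y ≡ true
  clean⇒H-edge S x y x-clean x∈S y∈S Kxy with x-clean y
  ... | c rewrite x∈S | y∈S | Kxy with H x y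
  ... | true = refl
  ... | false = ⊥-elim (true≢false c)

  -- Every missing edge leaving part k ends outside part k, so part k carries at
  -- most half of the missing degree sum; in particular at most half of it can
  -- come from touched vertices of part k.
  module _ (S : Sub) (k : ℕ) where
    private
      inside outside touched-in-k : ℕ
      inside = sumFin (λ x → ind (P x ≡ᵇ k) * mdeg S x)
      outside = sumFin (λ x → ind (not (P x ≡ᵇ k)) * mdeg S x)
      touched-in-k = count (λ x → inPart S k x ∧ touched S x)

      touched≤inside : touched-in-k ≤ inside
      touched≤inside =
        ≤-trans (≤-reflexive (count-as-sum (λ x → inPart S k x ∧ touched S x)))
                (sum-mono (λ x → at-most-degree (S x) (P x ≡ᵇ k) (mdeg S x)))
        where at-most-degree : ∀ a b d → ind ((a ∧ b) ∧ not (d ≡ᵇ 0)) ≤ ind b * d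
              at-most-degree false b d = z≤n
              at-most-degree true false d = z≤n
              at-most-degree true true zero = z≤n
              at-most-degree true true (suc d) = s≤s z≤n

      mtotal-split : mtotal S ≡ inside + outside
      mtotal-split = sum-cong (λ x → by-side (P x ≡ᵇ k) (mdeg S x))
                   ∙ sum-+ (λ x → ind (P x ≡ᵇ k) * mdeg S x) (λ x → ind (not (P x ≡ᵇ k)) * mdeg S x)
        where by-side : ∀ b d → d ≡ ind b * d + ind (not b) * d
              by-side true d = sym (+-identityʳ (d + 0) ∙ +-identityʳ d)
              by-side false d = sym (+-identityʳ d)

      weighted-degree : ∀ (b : Fin N → Bool) x →
        ind (b x) * mdeg S x ≡ sumFin (λ y → ind (b x) * ind (missing S x y))
      weighted-degree b x =
        cong (ind (b x) *_) (count-as-sum (missing S x)) ∙ sym (sum-* (ind (b x)) (λ y → ind (missing S x y)))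

      leaves-part : ∀ x y → ind (P x ≡ᵇ k) * ind (missing S x y) ≤ ind (not (P y ≡ᵇ k)) * ind (missing S y x)
      leaves-part x y rewrite missing-sym S y x with missing S x y in e
      ... | false = ≤-trans (≤-reflexive (*-zeroʳ (ind (P x ≡ᵇ k)))) z≤n
      ... | true with P x ≡ᵇ k in x∈k
      ... | false = z≤n
      ... | true rewrite ≢⇒≡ᵇ-false (P y) k (λ y∈k → K-edge⇒parts-differ x y (missing⇒K-edge S x y e)
                                                           (≡ᵇ⇒≡′ (P x) k x∈k ∙ sym y∈k)) = ≤-refl

      inside≤outside : inside ≤ outside
      inside≤outside = begin
        inside                                                                   ≡⟨ sum-cong (weighted-degree (λ x → P x ≡ᵇ k)) ⟩
        sumFin (λ x → sumFin (λ y → ind (P x ≡ᵇ k) * ind (missing S x y)))       ≤⟨ sum-mono (λ x → sum-mono (leaves-part x)) ⟩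
        sumFin (λ x → sumFin (λ y → ind (not (P y ≡ᵇ k)) * ind (missing S y x))) ≡⟨ sum-swap (λ x y → ind (not (P y ≡ᵇ k)) * ind (missing S y x)) ⟩
        sumFin (λ y → sumFin (λ x → ind (not (P y ≡ᵇ k)) * ind (missing S y x))) ≡⟨ sum-cong (λ y → sym (weighted-degree (λ x → not (P x ≡ᵇ k)) y)) ⟩
        outside                                                                  ∎
        where open ≤-Reasoning

    touched-in-part : 2 * count (λ x → inPart S k x ∧ touched S x) ≤ mtotal S
    touched-in-part = begin
      2 * touched-in-k                ≡⟨ cong (touched-in-k +_) (+-identityʳ touched-in-k) ⟩
      touched-in-k + touched-in-k     ≤⟨ +-mono-≤ touched≤inside (≤-trans touched≤inside inside≤outside) ⟩
      inside + outside                ≡⟨ sym mtotal-split ⟩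
      mtotal S                        ∎
      where open ≤-Reasoning

  -- If part k has more than n vertices and the missing degree sum is below
  -- 2(n+1), at most n of them are touched, so part k has a clean vertex.
  clean-in-part : ∀ S k n → suc n ≤ size S k → mtotal S < 2 * suc n →
    ∃ λ x → inPart S k x ≡ true × Clean S x
  clean-in-part S k n big few
    with count-gap (inPart S k) (λ x → inPart S k x ∧ touched S x)
                   (≤-trans (s≤s few-touched) big)
    where few-touched : count (λ x → inPart S k x ∧ touched S x) ≤ n
          few-touched = s≤s⁻¹ (*-cancelˡ-< 2 _ _ (≤-<-trans (touched-in-part S k) few))
  ... | x , x∈k , untouched rewrite x∈k = x , x∈k , untouched⇒clean S x untouched

  record Pivot (S : Sub) : Set where
    field
      w : Fin N
      w∈S : S w ≡ true
      clean : ∀ k → k < r → k ≢ P w → ∃ λ x → inPart S k x ≡ true × Clean S x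
      progress : (∃ λ y → missing S w y ≡ true) ⊎ mtotal S ≡ 0

  -- The pivot is a touched
  -- vertex, chosen in part 0 if possible (then parts ≥ 1 have clean vertices by
  -- counting); otherwise part 0 is entirely clean.
  find-pivot : ∀ S n → 1 ≤ size S 0 → (∀ k → 1 ≤ k → k < r → suc n ≤ size S k) →
    mtotal S < 2 * suc n → Pivot S
  find-pivot S n part₀ others few
    with count-gap (inPart S 0) (λ _ → false) (subst (_< size S 0) (sym (count-false {N})) part₀)
  ... | a₀ , a₀∈0 , _ = pivot
    where
    clean-nonzero : ∀ k → k < r → k ≢ 0 → ∃ λ x → inPart S k x ≡ true × Clean S x
    clean-nonzero zero _ k≢0 = ⊥-elim (k≢0 refl)
    clean-nonzero (suc k) k<r _ = clean-in-part S (suc k) n (others (suc k) z<s k<r) few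

    clean-avoiding : ∀ {u} → P u ≡ 0 → ∀ k → k < r → k ≢ P u → ∃ λ x → inPart S k x ≡ true × Clean S x
    clean-avoiding Pu≡0 k k<r k≢Pu = clean-nonzero k k<r (λ k≡0 → k≢Pu (k≡0 ∙ sym Pu≡0))

    untouched-degree : ∀ d → not (d ≡ᵇ 0) ≡ false → d ≡ 0
    untouched-degree zero _ = refl

    pivot : Pivot S
    pivot with search (λ u → inPart S 0 u ∧ touched S u)
    ... | inj₁ (u , e) = record
      { w = u ; w∈S = ∧-true-left {S u} u∈0
      ; clean = clean-avoiding (≡ᵇ⇒≡′ (P u) 0 (∧-true-right {S u} u∈0))
      ; progress = inj₁ (touched⇒missing S u (∧-true-right {inPart S 0 u} e)) }
      where u∈0 = ∧-true-left {inPart S 0 u} e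
    ... | inj₂ part₀-untouched with search (touched S)
    ...   | inj₁ (u , e) = record
      { w = u ; w∈S = ∧-true-left {S u} (proj₂ u-missing) ; clean = clean-all ; progress = inj₁ u-missing }
      where
      u-missing = touched⇒missing S u e
      clean-all : ∀ k → k < r → k ≢ P u → ∃ λ x → inPart S k x ≡ true × Clean S x
      clean-all zero _ _ = a₀ , a₀∈0 , untouched⇒clean S a₀ a₀-untouched
        where a₀-untouched : touched S a₀ ≡ false
              a₀-untouched = subst (λ b → b ∧ touched S a₀ ≡ false) a₀∈0 (part₀-untouched a₀)
      clean-all (suc k) k<r _ = clean-nonzero (suc k) k<r (λ ())
    ...   | inj₂ none = record
      { w = a₀ ; w∈S = ∧-true-left {S a₀} a₀∈0
      ; clean = clean-avoiding (≡ᵇ⇒≡′ (P a₀) 0 (∧-true-right {S a₀} a₀∈0))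
      ; progress = inj₂ (sum-zero (mdeg S) (λ u → untouched-degree (mdeg S u) (none u))) }

  record Transversals (t : ℕ) (S : Sub) : Set where
    constructor transversals
    field
      vertex : Fin t → Fin r → Fin N
      in-S : ∀ a i → S (vertex a i) ≡ true
      in-part : ∀ a i → P (vertex a i) ≡ toℕ i
      disjoint : ∀ a b i j → vertex a i ≡ vertex b j → a ≡ b
      clique : ∀ a i j → i ≢ j → H (vertex a i) (vertex a j) ≡ true

  partIndex : Fin N → Fin r
  partIndex v = fromℕ< (P<r v)

  module Step (S : Sub) (pivot : Pivot S) where
    open Pivot pivot

    clean-at : ∀ i → toℕ i ≢ P w → ∃ λ x → inPart S (toℕ i) x ≡ true × Clean S x
    clean-at i = clean (toℕ i) (toℕ<n i)

    choose : (i : Fin r) → Dec (toℕ i ≡ P w) → Fin N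
    choose i (yes _) = w
    choose i (no i≢Pw) = proj₁ (clean-at i i≢Pw)

    c : Fin r → Fin N
    c i = choose i (toℕ i ≟ P w)

    choose∈S : ∀ i d → S (choose i d) ≡ true
    choose∈S i (yes _) = w∈S
    choose∈S i (no i≢Pw) = ∧-true-left {S (choose i (no i≢Pw))} (proj₁ (proj₂ (clean-at i i≢Pw)))

    choose-part : ∀ i d → P (choose i d) ≡ toℕ i
    choose-part i (yes i≡Pw) = sym i≡Pw
    choose-part i (no i≢Pw) = ≡ᵇ⇒≡′ _ _ (∧-true-right {S (choose i (no i≢Pw))} (proj₁ (proj₂ (clean-at i i≢Pw))))

    choose-clean : ∀ i d → toℕ i ≢ P w → Clean S (choose i d)
    choose-clean i (yes i≡Pw) i≢Pw = ⊥-elim (i≢Pw i≡Pw)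
    choose-clean i (no i≢Pw) _ = proj₂ (proj₂ (clean-at i i≢Pw))

    c∈S : ∀ i → S (c i) ≡ true
    c∈S i = choose∈S i (toℕ i ≟ P w)

    c-part : ∀ i → P (c i) ≡ toℕ i
    c-part i = choose-part i (toℕ i ≟ P w)

    c-clean : ∀ i → toℕ i ≢ P w → Clean S (c i)
    c-clean i = choose-clean i (toℕ i ≟ P w)

    -- at most one of two distinct vertices of c is the (possibly unclean) pivot
    c-clique : ∀ i j → i ≢ j → H (c i) (c j) ≡ true
    c-clique i j i≢j = by-pivot (toℕ i ≟ P w)
      where
      Kij : K (c i) (c j) ≡ true
      Kij = parts-differ⇒K-edge (c i) (c j) (λ eq → i≢j (toℕ-injective (sym (c-part i) ∙ eq ∙ c-part j)))
      by-pivot : Dec (toℕ i ≡ P w) → H (c i) (c j) ≡ true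
      by-pivot (no i≢Pw) = clean⇒H-edge S (c i) (c j) (c-clean i i≢Pw) (c∈S i) (c∈S j) Kij
      by-pivot (yes i≡Pw) = H-sym (c i) (c j) ∙ clean⇒H-edge S (c j) (c i) (c-clean j j≢Pw) (c∈S j) (c∈S i)
                                                  (K-sym (c j) (c i) ∙ Kij)
        where j≢Pw : toℕ j ≢ P w
              j≢Pw j≡Pw = i≢j (toℕ-injective (i≡Pw ∙ sym j≡Pw))

    partIndex-c : ∀ i → partIndex (c i) ≡ i
    partIndex-c i = toℕ-injective (toℕ-fromℕ< (P<r (c i)) ∙ c-part i)

    c-meets-w : c (partIndex w) ≡ w
    c-meets-w with toℕ (partIndex w) ≟ P w
    ... | yes _ = refl
    ... | no ne = ⊥-elim (ne (toℕ-fromℕ< (P<r w)))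

    -- v belongs to the clique c (which meets v's part exactly in c (partIndex v))
    onClique : Fin N → Bool
    onClique v = is (c (partIndex v)) v

    S′ : Sub
    S′ v = S v ∧ not (onClique v)

    S′⊆S : ∀ v → S′ v ≡ true → S v ≡ true
    S′⊆S v e = ∧-true-left {S v} e

    c∉S′ : ∀ i → S′ (c i) ≡ false
    c∉S′ i rewrite partIndex-c i | ≡ᵇ-refl (toℕ (c i)) = ∧-zeroʳ (S (c i))

    w∉S′ : S′ w ≡ false
    w∉S′ = subst (λ x → S′ x ≡ false) c-meets-w (c∉S′ (partIndex w))

    size-drop : ∀ k → (k<r : k < r) → size S k ≤ size S′ k + 1
    size-drop k k<r = count-≤-+1 (inPart S′ k) (inPart S k) (c (fromℕ< k<r)) kept-or-removed
      where
      kept-or-removed : ∀ v → inPart S k v ≡ true → inPart S′ k v ≡ true ⊎ v ≡ c (fromℕ< k<r)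
      kept-or-removed v e with onClique v in removed
      ... | false rewrite ∧-true-left {S v} e = inj₁ (∧-true-right {S v} e)
      ... | true = inj₂ (sym (toℕ-injective (≡ᵇ⇒≡′ _ _ removed))
                        ∙ cong c (toℕ-injective (toℕ-fromℕ< (P<r v) ∙ ≡ᵇ⇒≡′ (P v) k (∧-true-right {S v} e)
                                                  ∙ sym (toℕ-fromℕ< k<r))))

    mdeg-mono : ∀ u → mdeg S′ u ≤ mdeg S u
    mdeg-mono u = subst₂ _≤_ (sym (count-as-sum (missing S′ u))) (sym (count-as-sum (missing S u)))
                    (sum-mono (λ v → ind-mono (missing-mono S S′ S′⊆S u v)))

    mtotal-mono : mtotal S′ ≤ mtotal S
    mtotal-mono = sum-mono mdeg-mono

    mdeg-drop : ∀ u v → missing S u v ≡ true → missing S′ u v ≡ false → mdeg S′ u < mdeg S u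
    mdeg-drop u v e e′ = subst₂ _<_ (sym (count-as-sum (missing S′ u))) (sym (count-as-sum (missing S u)))
      (sum-< (λ v → ind-mono (missing-mono S S′ S′⊆S u v)) v
             (subst₂ (λ a b → ind a < ind b) (sym e′) (sym e) ≤-refl))

    -- a missing edge at the pivot disappears, lowering both of its ends' degrees
    mtotal-drop : ∀ y → missing S w y ≡ true → 2 + mtotal S′ ≤ mtotal S
    mtotal-drop y e = sum-<₂ mdeg-mono w y w≢y (mdeg-drop w y e w-side) (mdeg-drop y w (missing-sym S y w ∙ e) y-side)
      where
      w≢y : w ≢ y
      w≢y refl = true≢false (sym (missing⇒K-edge S w w e) ∙ K-irr w)
      w-side : missing S′ w y ≡ false
      w-side rewrite w∉S′ = refl
      y-side : missing S′ y w ≡ false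
      y-side rewrite w∉S′ = ∧-zeroʳ (S′ y)

  -- Invariant: part 0 of S has at least t vertices, the other parts at least
  -- n ≥ t, and S has fewer than n missing edges (its missing degree sum is at
  -- most 2n − 1).  A greedy step keeps the invariant with t and n lowered by one,
  -- so S contains t disjoint transversal cliques of H.
  greedy : (t n : ℕ) (S : Sub) → t ≤ n → t ≤ size S 0 → (∀ k → 1 ≤ k → k < r → n ≤ size S k) →
    mtotal S ≤ 2 * n ∸ 1 → Transversals t S
  greedy zero n S _ _ _ _ = transversals (λ ()) (λ ()) (λ ()) (λ ()) (λ ())
  greedy (suc t) (suc n) S t≤n part₀ others few = transversals f f∈S f-part f-disjoint f-clique
    where
    pivot = find-pivot S n (≤-trans (s≤s z≤n) part₀) others (s≤s few)
    open Step S pivot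

    -- 2(n+1) − 1 = 2 + (2n − 1), and the step removes at least two from mtotal
    -- (or there was nothing to remove)
    few′ : mtotal S′ ≤ 2 * n ∸ 1
    few′ with Pivot.progress pivot
    ... | inj₁ (y , e) = ∸-monoˡ-≤ 1 (s≤s⁻¹ (subst (2 + mtotal S′ ≤_) (+-suc n (n + 0)) (≤-trans (mtotal-drop y e) few)))
    ... | inj₂ none = ≤-trans mtotal-mono (subst (_≤ 2 * n ∸ 1) (sym none) z≤n)

    shrink : ∀ {a b} → suc a ≤ b + 1 → a ≤ b
    shrink {a} {b} le = s≤s⁻¹ (subst (suc a ≤_) (+-comm b 1) le)

    -- the pivot's part shows 0 < r, so part 0 exists and loses at most one vertex
    rest : Transversals t S′
    rest = greedy t n S′ (s≤s⁻¹ t≤n)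
             (shrink (≤-trans part₀ (size-drop 0 (≤-trans (s≤s z≤n) (P<r (Pivot.w pivot))))))
             (λ k k≥1 k<r → shrink (≤-trans (others k k≥1 k<r) (size-drop k k<r)))
             few′

    open Transversals rest renaming (vertex to g; in-S to g∈S′; in-part to g-part; disjoint to g-disjoint; clique to g-clique)

    f : Fin (suc t) → Fin r → Fin N
    f F.zero = c
    f (F.suc a) = g a

    f∈S : ∀ a i → S (f a i) ≡ true
    f∈S F.zero i = c∈S i
    f∈S (F.suc a) i = S′⊆S (g a i) (g∈S′ a i)

    f-part : ∀ a i → P (f a i) ≡ toℕ i
    f-part F.zero = c-part
    f-part (F.suc a) = g-part a

    -- the new clique c is disjoint from the later ones, which live in S′
    f-disjoint : ∀ a b i j → f a i ≡ f b j → a ≡ b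
    f-disjoint F.zero F.zero i j e = refl
    f-disjoint F.zero (F.suc b) i j e = ⊥-elim (true≢false (sym (g∈S′ b j) ∙ cong S′ (sym e) ∙ c∉S′ i))
    f-disjoint (F.suc a) F.zero i j e = ⊥-elim (true≢false (sym (g∈S′ a i) ∙ cong S′ e ∙ c∉S′ j))
    f-disjoint (F.suc a) (F.suc b) i j e = cong F.suc (g-disjoint a b i j e)

    f-clique : ∀ a i j → i ≢ j → H (f a i) (f a j) ≡ true
    f-clique F.zero = c-clique
    f-clique (F.suc a) = g-clique a

  all : Sub
  all _ = true

  mtotal-all : mtotal all ≡ 2 * edges (K ∖ H)
  mtotal-all = handshake (K ∖ H) ∖-sym ∖-irr
    where
    ∖-sym : ∀ u v → (K ∖ H) u v ≡ (K ∖ H) v u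
    ∖-sym u v rewrite K-sym u v | H-sym u v = refl
    ∖-irr : ∀ u → (K ∖ H) u u ≡ false
    ∖-irr u rewrite K-irr u = refl

  few-missing⇒cliques : ∀ t n → t ≤ n → t ≤ size all 0 → (∀ k → 1 ≤ k → k < r → n ≤ size all k) →
    edges (K ∖ H) < n → ContainsDisjointCliques t r H
  few-missing⇒cliques t n t≤n part₀ others few
    with greedy t n all t≤n part₀ others (subst (_≤ 2 * n ∸ 1) (sym mtotal-all) (∸-monoˡ-≤ 1 (*-monoʳ-< 2 few)))
  ... | transversals f _ f-part f-disjoint f-clique =
    f , (λ a b i j e → f-disjoint a b i j e , toℕ-injective (sym (f-part a i) ∙ cong P e ∙ f-part b j)) , f-clique

double-choose-2 : ∀ n → 2 * (n C 2) ≡ n * (n ∸ 1)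
double-choose-2 zero = refl
double-choose-2 (suc n) = begin
  2 * (suc n C 2)             ≡⟨ cong (2 *_) (sym (nCk+nC[k+1]≡[n+1]C[k+1] n 1)) ⟩
  2 * (n C 1 + n C 2)         ≡⟨ cong (λ x → 2 * (x + n C 2)) (nC1≡n n) ⟩
  2 * (n + n C 2)             ≡⟨ *-distribˡ-+ 2 n (n C 2) ⟩
  2 * n + 2 * (n C 2)         ≡⟨ cong (2 * n +_) (double-choose-2 n) ⟩
  2 * n + n * (n ∸ 1)         ≡⟨ pascal n ⟩
  suc n * n                   ∎
  where
  open ≡-Reasoning
  pascal : ∀ n → 2 * n + n * (n ∸ 1) ≡ suc n * n
  pascal zero = refl
  pascal (suc k) = ring k
    where ring : ∀ k → 2 * (1 + k) + (1 + k) * k ≡ (2 + k) * (1 + k)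
          ring = solve-∀

module Layout (s n₁ n₂ : ℕ) where

  r : ℕ
  r = suc (suc s)

  N : ℕ
  N = verts r n₁ n₂

  P : Fin N → ℕ
  P = part r n₁ n₂

  open Multipartite P public

  part-left : ∀ i → P (i ↑ˡ (suc s * n₂)) ≡ 0
  part-left i rewrite splitAt-↑ˡ n₁ i (suc s * n₂) = refl

  part-right : ∀ j → P (n₁ ↑ʳ j) ≡ suc (toℕ (quotient {suc s} n₂ j))
  part-right j rewrite splitAt-↑ʳ n₁ (suc s * n₂) j = refl

  P<r : ∀ v → P v < r
  P<r v with splitAt n₁ v
  ... | inj₁ _ = s≤s z≤n
  ... | inj₂ w = s≤s (toℕ<n (quotient {suc s} n₂ w))

  sum-quotient : ∀ m (h : Fin m → ℕ) → sumFin {m * n₂} (λ j → h (quotient {m} n₂ j)) ≡ sumFin (λ q → n₂ * h q)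
  sum-quotient zero h = refl
  sum-quotient (suc m) h =
    sum-++ n₂ {m * n₂} (λ j → h (quotient {suc m} n₂ j))
    ∙ cong₂ _+_ (sum-cong {n₂} (λ i → cong h (quotient-left i)) ∙ sum-const {n₂} (h F.zero))
                (sum-cong {m * n₂} (λ j → cong h (quotient-right j)) ∙ sum-quotient m (λ q → h (F.suc q)))
    where
    quotient-left : ∀ i → quotient {suc m} n₂ (i ↑ˡ (m * n₂)) ≡ F.zero
    quotient-left i rewrite splitAt-↑ˡ n₂ i (m * n₂) = refl
    quotient-right : ∀ j → quotient {suc m} n₂ (n₂ ↑ʳ j) ≡ F.suc (quotient {m} n₂ j)
    quotient-right j rewrite splitAt-↑ʳ n₂ (m * n₂) j = refl

  sum-by-part : (g : ℕ → ℕ) → sumFin (λ u → g (P u)) ≡ n₁ * g 0 + sumFin (λ j → n₂ * g (suc (toℕ {suc s} j)))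
  sum-by-part g =
    sum-++ n₁ {suc s * n₂} (λ u → g (P u))
    ∙ cong₂ _+_ (sum-cong {n₁} (λ i → cong g (part-left i)) ∙ sum-const {n₁} (g 0))
                (sum-cong {suc s * n₂} (λ j → cong g (part-right j)) ∙ sum-quotient (suc s) (λ q → g (suc (toℕ q))))

  size₀ : count (λ v → P v ≡ᵇ 0) ≡ n₁
  size₀ = count-as-sum (λ v → P v ≡ᵇ 0) ∙ sum-by-part (λ q → ind (q ≡ᵇ 0))
        ∙ cong₂ _+_ (*-identityʳ n₁) (sum-zero {suc s} (λ _ → n₂ * 0) (λ _ → *-zeroʳ n₂)) ∙ +-identityʳ n₁

  size-other : ∀ k → suc k < r → count (λ v → P v ≡ᵇ suc k) ≡ n₂
  size-other k k<r = count-as-sum (λ v → P v ≡ᵇ suc k) ∙ sum-by-part (λ q → ind (q ≡ᵇ suc k))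
    ∙ cong₂ _+_ (*-zeroʳ n₁)
        (sum-* {suc s} n₂ (λ j → ind (toℕ j ≡ᵇ k))
         ∙ cong (n₂ *_) (sum-cong {suc s} (λ j → cong ind (≡ᵇ-sym (toℕ j) k ∙ cong (_≡ᵇ toℕ j) (sym (toℕ-fromℕ< k<r′))))
                         ∙ sym (count-as-sum (is k′)) ∙ count-is k′)
         ∙ *-identityʳ n₂)
    where
    k<r′ : k < suc s
    k<r′ = s≤s⁻¹ k<r
    k′ : Fin (suc s)
    k′ = fromℕ< k<r′

  degree-of-part : ℕ → ℕ
  degree-of-part p = n₁ * ind (not (p ≡ᵇ 0)) + sumFin {suc s} (λ j → n₂ * ind (not (p ≡ᵇ suc (toℕ j))))

  degree : ∀ u → count (K u) ≡ degree-of-part (P u)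
  degree u = count-as-sum (K u) ∙ sum-by-part (λ q → ind (not (P u ≡ᵇ q)))

  degree-part₀ : degree-of-part 0 ≡ suc s * n₂
  degree-part₀ = cong₂ _+_ (*-zeroʳ n₁) (sum-cong {suc s} (λ _ → *-identityʳ n₂) ∙ sum-const {suc s} n₂)

  degree-other : ∀ (i : Fin (suc s)) → degree-of-part (suc (toℕ i)) ≡ n₁ + n₂ * s
  degree-other i = cong₂ _+_ (*-identityʳ n₁)
    (sum-* n₂ (λ j → ind (not (is i j))) ∙ cong (n₂ *_) (sym (count-as-sum (λ j → not (is i j))) ∙ others))
    where others : count (λ j → not (is i j)) ≡ s
          others = +-cancelʳ-≡ 1 _ s (cong (count (λ j → not (is i j)) +_) (sym (count-is i))
                                      ∙ count-not (is i) ∙ +-comm 1 s)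

  total : ℕ
  total = suc s * n₁ * n₂ + (suc s C 2) * n₂ ^ 2

  edges-K : edges K ≡ total
  edges-K = *-cancelˡ-≡ (edges K) total 2 (begin
    2 * edges K                                       ≡⟨ sym (handshake K K-sym K-irr) ⟩
    sumFin (λ u → count (K u))                        ≡⟨ sum-cong {N} degree ∙ sum-by-part degree-of-part ⟩
    n₁ * degree-of-part 0 + sumFin (λ i → n₂ * degree-of-part (suc (toℕ {suc s} i)))
                                                      ≡⟨ cong₂ _+_ (cong (n₁ *_) degree-part₀)
                                                                   (sum-cong {suc s} (λ i → cong (n₂ *_) (degree-other i))) ⟩
    n₁ * (suc s * n₂) + sumFin {suc s} (λ _ → n₂ * (n₁ + n₂ * s))
                                                      ≡⟨ cong (n₁ * (suc s * n₂) +_) (sum-const {suc s} (n₂ * (n₁ + n₂ * s))) ⟩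
    n₁ * (suc s * n₂) + suc s * (n₂ * (n₁ + n₂ * s))  ≡⟨ ring s n₁ n₂ ⟩
    2 * (suc s * n₁ * n₂) + suc s * s * n₂ ^ 2        ≡⟨ cong (λ x → 2 * (suc s * n₁ * n₂) + x * n₂ ^ 2) (sym (double-choose-2 (suc s))) ⟩
    2 * (suc s * n₁ * n₂) + 2 * (suc s C 2) * n₂ ^ 2  ≡⟨ cong (2 * (suc s * n₁ * n₂) +_) (*-assoc 2 (suc s C 2) (n₂ ^ 2)) ⟩
    2 * (suc s * n₁ * n₂) + 2 * ((suc s C 2) * n₂ ^ 2) ≡⟨ sym (*-distribˡ-+ 2 (suc s * n₁ * n₂) _) ⟩
    2 * total                                         ∎)
    where
    open ≡-Reasoning
    ring : ∀ a b c → b * ((1 + a) * c) + (1 + a) * (c * (b + c * a)) ≡ 2 * ((1 + a) * b * c) + (1 + a) * a * (c * (c * 1))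
    ring = solve-∀

  upper-bound : n₁ ≤ n₂ → (H : Adj N) → IsSubgraph K H → ¬ ContainsDisjointCliques n₁ r H →
    edges H + n₂ ≤ total
  upper-bound n₁≤n₂ H (H-sym , H⊆K) no-cliques = begin
    edges H + n₂              ≤⟨ +-monoʳ-≤ (edges H) many-missing ⟩
    edges H + edges (K ∖ H)   ≡⟨ sym (edges-∖ K H H⊆K) ⟩
    edges K                   ≡⟨ edges-K ⟩
    total                     ∎
    where
    open ≤-Reasoning
    open Greedy r P P<r H H-sym H⊆K using (few-missing⇒cliques; size; all)
    others : ∀ k → 1 ≤ k → k < r → n₂ ≤ size all k
    others (suc k) _ k<r = ≤-reflexive (sym (size-other k k<r))
    many-missing : n₂ ≤ edges (K ∖ H)
    many-missing = ≮⇒≥ (λ few → no-cliques (few-missing⇒cliques n₁ n₂ n₁≤n₂ (≤-reflexive (sym size₀)) others few))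

module Extremal (s a n₂ : ℕ) where

  open Layout s (suc a) n₂

  z : Fin N
  z = F.zero

  Z : Fin N → Bool
  Z = is z

  O : Fin N → Bool
  O v = P v ≡ᵇ 1

  X : Adj N
  X u v = (Z u ∧ O v) ∨ (Z v ∧ O u)

  H₀ : Adj N
  H₀ = K ∖ X

  Z⇒part₀ : ∀ u → Z u ≡ true → P u ≡ 0
  Z⇒part₀ u e with toℕ-injective {i = z} {j = u} (≡ᵇ⇒≡′ 0 (toℕ u) e)
  ... | refl = refl

  Z⇒¬O : ∀ u → Z u ≡ true → O u ≡ false
  Z⇒¬O u e rewrite Z⇒part₀ u e = refl

  X-sym : ∀ u v → X u v ≡ X v u
  X-sym u v = ∨-comm (Z u ∧ O v) (Z v ∧ O u)

  X⊆K : ∀ u v → X u v ≡ true → K u v ≡ true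
  X⊆K u v e with Z u ∧ O v in zu∧ov
  ... | true = parts-differ⇒K-edge u v
        (λ eq → 0≢1+n (sym (Z⇒part₀ u (∧-true-left zu∧ov)) ∙ eq ∙ ≡ᵇ⇒≡′ (P v) 1 (∧-true-right {Z u} zu∧ov)))
  ... | false = parts-differ⇒K-edge u v
        (λ eq → 0≢1+n (sym (Z⇒part₀ v (∧-true-left e)) ∙ sym eq ∙ ≡ᵇ⇒≡′ (P u) 1 (∧-true-right {Z v} e)))

  X-irr : ∀ u → X u u ≡ false
  X-irr u with Z u in zu
  ... | false = refl
  ... | true rewrite Z⇒¬O u zu = refl

  -- a deleted edge joins z to part 1, so it is seen from exactly one of its ends as "z to part 1"
  X-split : ∀ u v → ind (X u v) ≡ ind (Z u ∧ O v) + ind (Z v ∧ O u)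
  X-split u v with Z u in zu
  ... | false = refl
  ... | true rewrite Z⇒¬O u zu | ∧-zeroʳ (Z v) with O v
  ...   | true = refl
  ...   | false = refl

  edges-X : edges X ≡ n₂
  edges-X = *-cancelˡ-≡ (edges X) n₂ 2 (begin
    2 * edges X                                                       ≡⟨ sym (handshake X X-sym X-irr) ⟩
    sumFin (λ u → count (X u))                                        ≡⟨ sum-cong (λ u → count-as-sum (X u) ∙ sum-cong (X-split u)
                                                                                        ∙ sum-+ (λ v → ind (Z u ∧ O v)) (λ v → ind (Z v ∧ O u))) ⟩
    sumFin (λ u → sumFin (λ v → ind (Z u ∧ O v)) + sumFin (λ v → ind (Z v ∧ O u)))
                                                                      ≡⟨ sum-+ (λ u → sumFin (λ v → ind (Z u ∧ O v))) (λ u → sumFin (λ v → ind (Z v ∧ O u))) ⟩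
    C + sumFin (λ u → sumFin (λ v → ind (Z v ∧ O u)))                 ≡⟨ cong (C +_) (sum-swap (λ u v → ind (Z v ∧ O u))) ⟩
    C + C                                                             ≡⟨ cong (λ x → x + x) C≡n₂ ∙ cong (n₂ +_) (sym (+-identityʳ n₂)) ⟩
    2 * n₂                                                            ∎)
    where
    open ≡-Reasoning
    C : ℕ
    C = sumFin (λ u → sumFin (λ v → ind (Z u ∧ O v)))
    C≡n₂ : C ≡ n₂
    C≡n₂ = sum-product Z O ∙ cong₂ _*_ (count-is z) (size-other 0 (s≤s (s≤s z≤n))) ∙ +-identityʳ n₂

  deleted : ∀ u v → Z u ≡ true → O v ≡ true → H₀ u v ≡ false
  deleted u v zu ov rewrite zu | ov = ∧-zeroʳ (K u v)

  H₀-subgraph : IsSubgraph K H₀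
  H₀-subgraph = (λ u v → cong₂ (λ k x → k ∧ not x) (K-sym u v) (X-sym u v)) , (λ u v → ∧-true-left {K u v})

  edges-H₀ : edges H₀ + n₂ ≡ total
  edges-H₀ = cong (edges H₀ +_) (sym edges-X) ∙ +-comm (edges H₀) (edges X) ∙ sym (edges-∖ K X X⊆K) ∙ edges-K

  part₀-initial : ∀ v → P v ≡ 0 → toℕ v < suc a
  part₀-initial v e with splitAt (suc a) v in eq
  ... | inj₁ w = subst (λ x → toℕ x < suc a) (splitAt⁻¹-↑ˡ eq) (subst (_< suc a) (sym (toℕ-↑ˡ w _)) (toℕ<n w))
  ... | inj₂ w = ⊥-elim (0≢1+n (sym e))

  -- H₀ contains no a+1 disjoint copies of K_r: a copy meets every part, so the
  -- copies exhaust part 0 and one of them contains z, which in H₀ has no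
  -- neighbour in part 1.
  H₀-free : ¬ ContainsDisjointCliques (suc a) r H₀
  H₀-free (f , disjoint , clique) = true≢false (sym z-edge ∙ z-no-edge)
    where
    partIndex : Fin N → Fin r
    partIndex v = fromℕ< (P<r v)

    parts-injective : ∀ b → Injective _≡_ _≡_ (λ i → partIndex (f b i))
    parts-injective b {i} {j} e with i F.≟ j
    ... | yes i≡j = i≡j
    ... | no i≢j = ⊥-elim (K-edge⇒parts-differ (f b i) (f b j) (∧-true-left (clique b i j i≢j))
                            (sym (toℕ-fromℕ< (P<r (f b i))) ∙ cong toℕ e ∙ toℕ-fromℕ< (P<r (f b j))))

    meets : ∀ b k → k < r → ∃ λ i → P (f b i) ≡ k
    meets b k k<r with injective⇒surjective (λ i → partIndex (f b i)) (parts-injective b) (fromℕ< k<r)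
    ... | i , e = i , (sym (toℕ-fromℕ< (P<r (f b i))) ∙ cong toℕ e ∙ toℕ-fromℕ< k<r)

    -- the vertex of copy b in part 0, as an element of Fin n₁
    root : Fin (suc a) → Fin r
    root b = proj₁ (meets b 0 z<s)
    root-index : Fin (suc a) → Fin (suc a)
    root-index b = fromℕ< (part₀-initial (f b (root b)) (proj₂ (meets b 0 z<s)))
    root-index-toℕ : ∀ b → toℕ (root-index b) ≡ toℕ (f b (root b))
    root-index-toℕ b = toℕ-fromℕ< (part₀-initial (f b (root b)) (proj₂ (meets b 0 z<s)))
    root-injective : Injective _≡_ _≡_ root-index
    root-injective {b} {c} e =
      proj₁ (disjoint b c (root b) (root c) (toℕ-injective (sym (root-index-toℕ b) ∙ cong toℕ e ∙ root-index-toℕ c)))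

    b₀ : Fin (suc a)
    b₀ = proj₁ (injective⇒surjective root-index root-injective F.zero)
    b₀-at-z : toℕ (f b₀ (root b₀)) ≡ 0
    b₀-at-z = sym (root-index-toℕ b₀) ∙ cong toℕ (proj₂ (injective⇒surjective root-index root-injective F.zero))

    i₁ : Fin r
    i₁ = proj₁ (meets b₀ 1 (s≤s (s≤s z≤n)))
    i₁-part : P (f b₀ i₁) ≡ 1
    i₁-part = proj₂ (meets b₀ 1 (s≤s (s≤s z≤n)))
    root≢i₁ : root b₀ ≢ i₁
    root≢i₁ e = 0≢1+n (sym (proj₂ (meets b₀ 0 z<s)) ∙ cong (λ i → P (f b₀ i)) e ∙ i₁-part)

    z-edge : H₀ (f b₀ (root b₀)) (f b₀ i₁) ≡ true
    z-edge = clique b₀ (root b₀) i₁ root≢i₁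
    z-no-edge : H₀ (f b₀ (root b₀)) (f b₀ i₁) ≡ false
    z-no-edge = deleted (f b₀ (root b₀)) (f b₀ i₁) (cong (0 ≡ᵇ_) b₀-at-z) (cong (_≡ᵇ 1) i₁-part)

rhs+n₂≡total : ∀ s a n₂ →
  suc s * suc a * n₂ + (suc s C 2) * n₂ ^ 2 ∸ suc a * n₂ + n₂ * a + n₂ ≡ Layout.total s (suc a) n₂
rhs+n₂≡total s a n₂ = begin
  E ∸ m + n₂ * a + n₂      ≡⟨ +-assoc (E ∸ m) (n₂ * a) n₂ ⟩
  E ∸ m + (n₂ * a + n₂)    ≡⟨ cong (E ∸ m +_) (+-comm (n₂ * a) n₂ ∙ cong (n₂ +_) (*-comm n₂ a)) ⟩
  E ∸ m + m                ≡⟨ m∸n+n≡m m≤E ⟩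
  E                        ∎
  where
  open ≡-Reasoning
  E m : ℕ
  E = Layout.total s (suc a) n₂
  m = suc a * n₂
  m≤E : m ≤ E
  m≤E = ≤-trans (m≤m+n m (s * m)) (≤-trans (≤-reflexive (sym (*-assoc (suc s) (suc a) n₂))) (m≤m+n _ _))

lemma3 : (r n₁ n₂ : ℕ) → 3 ≤ r → 1 ≤ n₁ → n₁ ≤ n₂ →
    ExEq (Kpart r n₁ n₂) n₁ r
      ((r ∸ 1) * n₁ * n₂ + ((r ∸ 1) C 2) * n₂ ^ 2 ∸ n₁ * n₂ + n₂ * (n₁ ∸ 1))
lemma3 (suc zero) _ _ (s≤s ()) _ _
lemma3 (suc (suc zero)) _ _ (s≤s (s≤s ())) _ _
lemma3 (suc (suc (suc r′))) (suc a) n₂ _ _ n₁≤n₂ =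
  (H₀ , H₀-subgraph , H₀-free , +-cancelʳ-≡ n₂ _ _ (edges-H₀ ∙ sym rhs)) ,
  (λ H H⊆K no-cliques → +-cancelʳ-≤ n₂ _ _ (≤-trans (upper-bound n₁≤n₂ H H⊆K no-cliques) (≤-reflexive (sym rhs))))
  where
  open Layout (suc r′) (suc a) n₂ using (upper-bound)
  open Extremal (suc r′) a n₂ using (H₀; H₀-subgraph; H₀-free; edges-H₀)
  rhs = rhs+n₂≡total (suc r′) a n₂
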